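{- Let $f\colon\mathbb{N}_0\to\mathbb{N}_0$ be a multiplicative arithmetic function (i.e. $f(1)=1$ and $f(mn)=f(m)f(n)$ for coprime $m,n\in\mathbb{N}$) such that for all primes $p$ and positive integers $\alpha$: (I) $f(p^{\alpha})<p^{\alpha}$; (II) $f(p)\mid f(p^{\alpha})$; (III) every prime $q$ dividing $f(p^{\alpha})$ divides $p\,f(p)$; and (IV) $f(0)=0$. Define $S$ as below. Let $k,r\in\mathbb{N}$. Then $f^r(k)\in S$ if and only if $k\in S$.
   Context: $f^0(n)=n$, $f^{k+1}(n)=f(f^k(n))$. For $n\in\mathbb{N}$, $H(n)=\lim_{m\to\infty}f^m(n)$ (this limit exists and equals $f^n(n)\in\{0,1\}$). $Q=\{q \text{ prime}: H(q)=0\}$ and $S=\{n\in\mathbb{N}: q\nmid n \text{ for all } q\in Q\}$ (so $0\notin S$). -}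

module Defs where

open import Data.Nat using (ℕ; zero; suc; _*_; _^_; _<_; _≤_; _≥_)
open import Data.Nat.Divisibility using (_∣_)
open import Data.Nat.Primality using (Prime)
open import Data.Nat.Coprimality using (Coprime)
open import Data.Product using (Σ; _×_)
open import Relation.Binary.PropositionalEquality using (_≡_)
open import Relation.Nullary using (¬_)

iter : (ℕ → ℕ) → ℕ → ℕ → ℕ
iter f zero    n = n
iter f (suc k) n = f (iter f k n)

-- lim_{m→∞} f^m(n) = v  (for ℕ-valued sequences: eventually equal to v)
LimIs : (ℕ → ℕ) → ℕ → ℕ → Set
LimIs f n v = Σ ℕ λ M → ∀ m → M ≤ m → iter f m n ≡ v

InQ : (ℕ → ℕ) → ℕ → Set
InQ f q = Prime q × LimIs f q 0

InS : (ℕ → ℕ) → ℕ → Set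
InS f n = (1 ≤ n) × (∀ q → InQ f q → ¬ (q ∣ n))

Multiplicative : (ℕ → ℕ) → Set
Multiplicative f =
  (f 1 ≡ 1) × (∀ m n → 1 ≤ m → 1 ≤ n → Coprime m n → f (m * n) ≡ f m * f n)

CondI : (ℕ → ℕ) → Set
CondI f = ∀ p α → Prime p → 1 ≤ α → f (p ^ α) < p ^ α

CondII : (ℕ → ℕ) → Set
CondII f = ∀ p α → Prime p → 1 ≤ α → f p ∣ f (p ^ α)

CondIII : (ℕ → ℕ) → Set
CondIII f = ∀ p α → Prime p → 1 ≤ α → ∀ q → Prime q → q ∣ f (p ^ α) → q ∣ p * f p

CondIV : (ℕ → ℕ) → Set
CondIV f = f 0 ≡ 0

-- Call n *vanishing* if its orbit n, f(n), f²(n), … reaches 0, and *absorbed* if n = 0 or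
-- n has a vanishing prime divisor.  Since f(0) = 0, vanishing is the paper's condition
-- H(n) = 0, so Q is the set of vanishing primes and, for n ≥ 1, n ∈ S ⇔ n is not absorbed.
-- The heart of the proof is that vanishing and absorption coincide.  This is shown by strong
-- induction on n: for n ≥ 2 pick a prime p ∣ n, split n = p^α·m with p ∤ m, and use that
-- f(n) < n (from (I) and multiplicativity), f(n) = f(p^α)·f(m), that absorption of a product
-- is absorption of a factor, and that (II)-(III) make f(p^α) absorbed exactly when p vanishes.
-- Vanishing is plainly invariant along orbits, which gives the corollary.
module Submission where

open import Level using (0ℓ)
open import Data.Nat using (ℕ; zero; suc; _+_; _*_; _^_; _∸_; _≤_; _<_; z≤n; s≤s; NonZero; NonTrivial;
  nonTrivial⇒≢1; nonTrivial⇒n>1; >-nonZero⁻¹; ≢-nonZero⁻¹)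
open import Data.Nat.Properties
open import Data.Nat.Divisibility
open import Data.Nat.Primality
open import Data.Nat.Primality.Factorisation using (factorise)
open import Data.Nat.Coprimality using (Coprime; coprime-divisor)
open import Data.Nat.Induction using (<-rec)
open import Data.Nat.ListAction using (product)
open import Data.List using (_∷_)
open import Data.List.Relation.Unary.All using (_∷_)
open import Data.Product using (_×_; _,_; proj₁; proj₂; ∃-syntax)
open import Data.Sum using (_⊎_; inj₁; inj₂; [_,_]′; map)
open import Data.Sum.Function.Propositional using (_⊎-⇔_)
open import Function.Base using (it)
open import Function.Bundles using (_⇔_; mk⇔; Equivalence)
open import Function.Construct.Composition using (_⇔-∘_)
open import Function.Construct.Symmetry using (⇔-sym)
open import Function.Properties.Equivalence using (⇔-setoid)
open import Function.Related.TypeIsomorphisms using (¬-cong-⇔)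
open import Relation.Nullary using (¬_; yes; no; contradiction)
open import Relation.Binary.PropositionalEquality
import Relation.Binary.Reasoning.Setoid as SetoidReasoning

open import Defs

prime>1 : ∀ {p} → Prime p → 1 < p
prime>1 {p} prime-p = nonTrivial⇒n>1 p {{prime⇒nonTrivial prime-p}}

prime≢1 : ∀ {p} → Prime p → p ≢ 1
prime≢1 prime-p = nonTrivial⇒≢1 {{prime⇒nonTrivial prime-p}}

primeDivisor : ∀ n → 2 ≤ n → ∃[ p ] Prime p × p ∣ n
primeDivisor (suc zero) (s≤s ())
primeDivisor n@(suc (suc _)) _ with factorise n
... | record { factors = p ∷ ps ; isFactorisation = n≡p*ps ; factorsPrime = prime-p ∷ _ } =
  p , prime-p , divides (product ps) (trans n≡p*ps (*-comm p (product ps)))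

prime∣prime⇒≡ : ∀ {q p} → Prime q → Prime p → q ∣ p → q ≡ p
prime∣prime⇒≡ prime-q prime-p q∣p with prime⇒irreducible prime-p q∣p
... | inj₁ q≡1 = contradiction q≡1 (prime≢1 prime-q)
... | inj₂ q≡p = q≡p

prime∣pow⇒∣ : ∀ {q p} α → Prime q → q ∣ p ^ α → q ∣ p
prime∣pow⇒∣ zero    prime-q q∣1 = contradiction (∣1⇒≡1 q∣1) (prime≢1 prime-q)
prime∣pow⇒∣ {p = p} (suc α) prime-q q∣p*pᵅ with euclidsLemma p (p ^ α) prime-q q∣p*pᵅ
... | inj₁ q∣p  = q∣p
... | inj₂ q∣pᵅ = prime∣pow⇒∣ α prime-q q∣pᵅ

-- A number divisible by every prime is 0: otherwise a prime factor of n + 1 would divide 1.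
divisibleByAllPrimes⇒0 : ∀ {n} → (∀ q → Prime q → q ∣ n) → n ≡ 0
divisibleByAllPrimes⇒0 {zero}  _   = refl
divisibleByAllPrimes⇒0 {suc n} all∣n with primeDivisor (suc (suc n)) (s≤s (s≤s z≤n))
... | q , prime-q , q∣n+2 =
  contradiction (∣1⇒≡1 (∣m+n∣m⇒∣n (subst (q ∣_) (+-comm 1 (suc n)) q∣n+2) (all∣n q prime-q)))
                (prime≢1 prime-q)

coprime-*ˡ : ∀ {a b m} → Coprime a m → Coprime b m → Coprime (a * b) m
coprime-*ˡ a⊥m b⊥m (d∣ab , d∣m) =
  b⊥m (coprime-divisor (λ (e∣d , e∣a) → a⊥m (e∣a , ∣-trans e∣d d∣m)) d∣ab , d∣m)

coprime-^ˡ : ∀ {a m} α → Coprime a m → Coprime (a ^ α) m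
coprime-^ˡ zero    _   (d∣1 , _) = ∣1⇒≡1 d∣1
coprime-^ˡ (suc α) a⊥m = coprime-*ˡ a⊥m (coprime-^ˡ α a⊥m)

prime∤⇒coprime : ∀ {p m} → Prime p → ¬ p ∣ m → Coprime p m
prime∤⇒coprime prime-p p∤m (d∣p , d∣m) with prime⇒irreducible prime-p d∣p
... | inj₁ d≡1    = d≡1
... | inj₂ refl   = contradiction d∣m p∤m

record Split (p n : ℕ) : Set where
  field
    exponent      : ℕ
    cofactor      : ℕ
    p∤cofactor    : ¬ p ∣ cofactor
    decomposition : n ≡ p ^ exponent * cofactor

split : ∀ {p} → Prime p → ∀ n → .{{NonZero n}} → Split p n
split {p} prime-p n = <-rec (λ n → .{{NonZero n}} → Split p n) step n
  where
  instance
    p-nontrivial : NonTrivial p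
    p-nontrivial = prime⇒nonTrivial prime-p
  step : ∀ n → (∀ {m} → m < n → .{{NonZero m}} → Split p m) → .{{NonZero n}} → Split p n
  step n rec with p ∣? n
  ... | no p∤n = record { exponent = 0 ; cofactor = n ; p∤cofactor = p∤n
                        ; decomposition = sym (*-identityˡ n) }
  ... | yes p∣n = record { exponent = suc α ; cofactor = m ; p∤cofactor = p∤m
                         ; decomposition = n≡p*pᵅ*m }
    where
    instance
      quotient-nonzero : NonZero (quotient p∣n)
      quotient-nonzero = quotient≢0 p∣n
    open Split (rec (quotient-< p∣n)) renaming (exponent to α; cofactor to m; p∤cofactor to p∤m)
    n≡p*pᵅ*m : n ≡ p * p ^ α * m
    n≡p*pᵅ*m = begin
      n                   ≡⟨ m∣n⇒n≡m*quotient p∣n ⟩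
      p * quotient p∣n    ≡⟨ cong (p *_) decomposition ⟩
      p * (p ^ α * m)     ≡⟨ *-assoc p (p ^ α) m ⟨
      p * p ^ α * m       ∎
      where open ≡-Reasoning

module _ {p n : ℕ} (prime-p : Prime p) where
  open Split

  split-exponent≥1 : (s : Split p n) → p ∣ n → 1 ≤ exponent s
  split-exponent≥1 record { exponent = zero ; p∤cofactor = p∤m ; decomposition = n≡m } p∣n =
    contradiction (subst (p ∣_) (trans n≡m (*-identityˡ _)) p∣n) p∤m
  split-exponent≥1 record { exponent = suc _ } _ = s≤s z≤n

  split-cofactor≢0 : (s : Split p n) → .{{NonZero n}} → NonZero (cofactor s)
  split-cofactor≢0 s = m*n≢0⇒n≢0 (p ^ exponent s) {{subst NonZero (decomposition s) it}}

  split-cofactor< : (s : Split p n) → p ∣ n → .{{NonZero n}} → cofactor s < n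
  split-cofactor< s p∣n = begin-strict
    cofactor s                   <⟨ m<m*n (cofactor s) (p ^ exponent s) 1<pᵅ ⟩
    cofactor s * p ^ exponent s  ≡⟨ *-comm (cofactor s) (p ^ exponent s) ⟩
    p ^ exponent s * cofactor s  ≡⟨ decomposition s ⟨
    n                            ∎
    where
    open ≤-Reasoning
    instance
      cofactor-nonzero : NonZero (cofactor s)
      cofactor-nonzero = split-cofactor≢0 s
    1<pᵅ : 1 < p ^ exponent s
    1<pᵅ = ^-monoʳ-< p (prime>1 prime-p) (split-exponent≥1 s p∣n)

  split-coprime : (s : Split p n) → Coprime (p ^ exponent s) (cofactor s)
  split-coprime s = coprime-^ˡ (exponent s) (prime∤⇒coprime prime-p (p∤cofactor s))

module _ {f : ℕ → ℕ} (multiplicative : Multiplicative f) where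
  open Split

  f-split : ∀ {p n} → Prime p → (s : Split p n) → .{{NonZero n}} →
            f n ≡ f (p ^ exponent s) * f (cofactor s)
  f-split {p} prime-p s = trans (cong f (decomposition s))
    (proj₂ multiplicative (p ^ exponent s) (cofactor s) 1≤pᵅ 1≤m (split-coprime prime-p s))
    where
    instance
      p-nonzero : NonZero p
      p-nonzero = prime⇒nonZero prime-p
    1≤pᵅ : 1 ≤ p ^ exponent s
    1≤pᵅ = m^n>0 p (exponent s)
    1≤m : 1 ≤ cofactor s
    1≤m  = >-nonZero⁻¹ (cofactor s) {{split-cofactor≢0 prime-p s}}

  f≤id-from-f<id : ∀ {m} → (2 ≤ m → f m < m) → 1 ≤ m → f m ≤ m
  f≤id-from-f<id {suc zero}    _   _ = ≤-reflexive (proj₁ multiplicative)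
  f≤id-from-f<id {suc (suc _)} f<m _ = <⇒≤ (f<m (s≤s (s≤s z≤n)))

  module _ (condI : CondI f) where

    -- Condition (I) on prime powers propagates, through a split, to all n ≥ 2.
    f<id : ∀ n → 2 ≤ n → f n < n
    f<id = <-rec (λ n → 2 ≤ n → f n < n) step
      where
      step : ∀ n → (∀ {m} → m < n → 2 ≤ m → f m < m) → 2 ≤ n → f n < n
      step (suc zero) _ (s≤s ())
      step n@(suc (suc _)) rec 2≤n with primeDivisor n 2≤n
      ... | p , prime-p , p∣n = begin-strict
          f n           ≡⟨ f-split prime-p s ⟩
          f pᵅ * f m    ≤⟨ *-monoʳ-≤ (f pᵅ) (f≤id-from-f<id (rec m<n) 1≤m) ⟩
          f pᵅ * m      <⟨ *-monoˡ-< m (condI p (exponent s) prime-p (split-exponent≥1 prime-p s p∣n)) ⟩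
          pᵅ * m        ≡⟨ decomposition s ⟨
          n             ∎
        where
        open ≤-Reasoning
        s : Split p n
        s = split prime-p n
        pᵅ m : ℕ
        pᵅ = p ^ exponent s
        m  = cofactor s
        m<n : m < n
        m<n = split-cofactor< prime-p s p∣n
        instance
          m-nonzero : NonZero m
          m-nonzero = split-cofactor≢0 prime-p s
        1≤m : 1 ≤ m
        1≤m = >-nonZero⁻¹ m

    f≤id : ∀ n → 1 ≤ n → f n ≤ n
    f≤id n = f≤id-from-f<id (f<id n)

Vanishes : (ℕ → ℕ) → ℕ → Set
Vanishes f n = ∃[ m ] iter f m n ≡ 0

module _ {f : ℕ → ℕ} where

  iter-suc : ∀ m n → iter f (suc m) n ≡ iter f m (f n)
  iter-suc zero    n = refl
  iter-suc (suc m) n = cong f (iter-suc m n)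

  iter-+ : ∀ d m n → iter f (d + m) n ≡ iter f d (iter f m n)
  iter-+ zero    m n = refl
  iter-+ (suc d) m n = cong f (iter-+ d m n)

  iter-fixed : ∀ {a} → f a ≡ a → ∀ m → iter f m a ≡ a
  iter-fixed fa≡a zero    = refl
  iter-fixed fa≡a (suc m) = trans (cong f (iter-fixed fa≡a m)) fa≡a

  fixed-point-¬vanishes : ∀ {a} → f a ≡ a → a ≢ 0 → ¬ Vanishes f a
  fixed-point-¬vanishes fa≡a a≢0 (m , fᵐa≡0) = a≢0 (trans (sym (iter-fixed fa≡a m)) fᵐa≡0)

  module _ (f0≡0 : f 0 ≡ 0) where

    -- Vanishing is invariant along orbits: 0 is a fixed point.
    vanishes-step : ∀ n → Vanishes f (f n) ⇔ Vanishes f n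
    vanishes-step n = mk⇔ forward backward
      where
      forward : Vanishes f (f n) → Vanishes f n
      forward (m , fᵐ⁺¹n≡0) = suc m , trans (iter-suc m n) fᵐ⁺¹n≡0
      backward : Vanishes f n → Vanishes f (f n)
      backward (zero  , n≡0)    = 0 , trans (cong f n≡0) f0≡0
      backward (suc m , fᵐ⁺¹n≡0) = m , trans (sym (iter-suc m n)) fᵐ⁺¹n≡0

    vanishes-iter : ∀ r n → Vanishes f (iter f r n) ⇔ Vanishes f n
    vanishes-iter zero    n = mk⇔ (λ v → v) (λ v → v)
    vanishes-iter (suc r) n = vanishes-iter r n ⇔-∘ vanishes-step (iter f r n)

    vanishes⇔limit : ∀ n → Vanishes f n ⇔ LimIs f n 0
    vanishes⇔limit n = mk⇔ (λ (m , fᵐn≡0) → m , stays-0 m fᵐn≡0) (λ (M , lim) → M , lim M ≤-refl)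
      where
      stays-0 : ∀ m → iter f m n ≡ 0 → ∀ m′ → m ≤ m′ → iter f m′ n ≡ 0
      stays-0 m fᵐn≡0 m′ m≤m′ = begin
        iter f m′ n                    ≡⟨ cong (λ k → iter f k n) (m∸n+n≡m m≤m′) ⟨
        iter f (m′ ∸ m + m) n          ≡⟨ iter-+ (m′ ∸ m) m n ⟩
        iter f (m′ ∸ m) (iter f m n)   ≡⟨ cong (iter f (m′ ∸ m)) fᵐn≡0 ⟩
        iter f (m′ ∸ m) 0              ≡⟨ iter-fixed f0≡0 (m′ ∸ m) ⟩
        0                              ∎
        where open ≡-Reasoning

module ⇔-Reasoning = SetoidReasoning (⇔-setoid 0ℓ)

Absorbed : (ℕ → ℕ) → ℕ → Set
Absorbed f n = n ≡ 0 ⊎ ∃[ q ] Prime q × Vanishes f q × q ∣ n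

module _ {f : ℕ → ℕ} where

  absorbed-∣ : ∀ {a b} → a ∣ b → Absorbed f a → Absorbed f b
  absorbed-∣ a∣b (inj₁ refl)                  = inj₁ (0∣⇒≡0 a∣b)
  absorbed-∣ a∣b (inj₂ (q , prime-q , vq , q∣a)) = inj₂ (q , prime-q , vq , ∣-trans q∣a a∣b)

  absorbed-* : ∀ a b → Absorbed f (a * b) ⇔ (Absorbed f a ⊎ Absorbed f b)
  absorbed-* a b = mk⇔ forward [ absorbed-∣ (m∣m*n b) , absorbed-∣ (n∣m*n a) ]′
    where
    forward : Absorbed f (a * b) → Absorbed f a ⊎ Absorbed f b
    forward (inj₁ ab≡0) = map inj₁ inj₁ (m*n≡0⇒m≡0∨n≡0 a ab≡0)
    forward (inj₂ (q , prime-q , vq , q∣ab)) =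
      map (λ q∣a → inj₂ (q , prime-q , vq , q∣a)) (λ q∣b → inj₂ (q , prime-q , vq , q∣b))
          (euclidsLemma a b prime-q q∣ab)

  ¬absorbed-1 : ¬ Absorbed f 1
  ¬absorbed-1 (inj₁ ())
  ¬absorbed-1 (inj₂ (q , prime-q , _ , q∣1)) = prime≢1 prime-q (∣1⇒≡1 q∣1)

  -- The only prime divisor of p ^ α is p.
  absorbed-prime-power : ∀ {p α} → Prime p → 1 ≤ α → Absorbed f (p ^ α) ⇔ Vanishes f p
  absorbed-prime-power {p} {suc α} prime-p _ = mk⇔ forward (λ vp → inj₂ (p , prime-p , vp , m∣m*n (p ^ α)))
    where
    forward : Absorbed f (p ^ suc α) → Vanishes f p
    forward (inj₁ pᵅ≡0) = contradiction (m^n≡0⇒m≡0 p (suc α) pᵅ≡0) (≢-nonZero⁻¹ p {{prime⇒nonZero prime-p}})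
    forward (inj₂ (q , prime-q , vq , q∣pᵅ)) =
      subst (Vanishes f) (prime∣prime⇒≡ prime-q prime-p (prime∣pow⇒∣ (suc α) prime-q q∣pᵅ)) vq

open Equivalence using (to; from)

module _ {f : ℕ → ℕ} (condIII : CondIII f) where

  -- By (III) every prime divides p · f(p) when f(p ^ α) = 0, so f(p) = 0.
  f-prime-power≡0 : ∀ {p α} → Prime p → 1 ≤ α → f (p ^ α) ≡ 0 → f p ≡ 0
  f-prime-power≡0 {p} {α} prime-p α≥1 fpᵅ≡0 =
    m*n≡0⇒m≡0 (f p) p {{prime⇒nonZero prime-p}} (trans (*-comm (f p) p) p*fp≡0)
    where
    p*fp≡0 : p * f p ≡ 0
    p*fp≡0 = divisibleByAllPrimes⇒0 λ q prime-q →
      condIII p α prime-p α≥1 q prime-q (subst (q ∣_) (sym fpᵅ≡0) (q ∣0))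

module _ {f : ℕ → ℕ} (condII : CondII f) (condIII : CondIII f) (condIV : CondIV f) where

  -- Given the main claim for f(p), conditions (II)-(III) identify absorption of f(p ^ α)
  -- with vanishing of p: prime divisors of f(p ^ α) are p or divide f(p), and f(p) ∣ f(p ^ α).
  absorbed-f-prime-power : ∀ {p α} → Prime p → 1 ≤ α → (Vanishes f (f p) ⇔ Absorbed f (f p)) →
                           Absorbed f (f (p ^ α)) ⇔ Vanishes f p
  absorbed-f-prime-power {p} {α} prime-p α≥1 claim-fp = mk⇔ forward backward
    where
    forward : Absorbed f (f (p ^ α)) → Vanishes f p
    forward (inj₁ fpᵅ≡0) = 1 , f-prime-power≡0 {f} condIII prime-p α≥1 fpᵅ≡0
    forward (inj₂ (q , prime-q , vq , q∣fpᵅ))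
      with euclidsLemma p (f p) prime-q (condIII p α prime-p α≥1 q prime-q q∣fpᵅ)
    ... | inj₁ q∣p  = subst (Vanishes f) (prime∣prime⇒≡ prime-q prime-p q∣p) vq
    ... | inj₂ q∣fp = to (vanishes-step condIV p) (from claim-fp (inj₂ (q , prime-q , vq , q∣fp)))
    backward : Vanishes f p → Absorbed f (f (p ^ α))
    backward vp = absorbed-∣ (condII p α prime-p α≥1) (to claim-fp (from (vanishes-step condIV p) vp))

module _ {f : ℕ → ℕ} (multiplicative : Multiplicative f) (condI : CondI f) (condII : CondII f)
         (condIII : CondIII f) (condIV : CondIV f) where
  open Split

  -- Main characterisation: the orbit of n reaches 0 iff n is absorbed.  For n ≥ 2 split
  -- n = p ^ α * m and use f(n) < n, f(n) = f(p ^ α) f(m), and induction at f(n), f(p), f(m), m.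
  vanishes⇔absorbed : ∀ n → Vanishes f n ⇔ Absorbed f n
  vanishes⇔absorbed = <-rec (λ n → Vanishes f n ⇔ Absorbed f n) step
    where
    step : ∀ n → (∀ {m} → m < n → Vanishes f m ⇔ Absorbed f m) → Vanishes f n ⇔ Absorbed f n
    step zero _ = mk⇔ (λ _ → inj₁ refl) (λ _ → 0 , refl)
    step (suc zero) _ = mk⇔ (λ v → contradiction v (fixed-point-¬vanishes (proj₁ multiplicative) 1+n≢0))
                            (λ a → contradiction a ¬absorbed-1)
    step n@(suc (suc _)) claim-below with primeDivisor n (s≤s (s≤s z≤n))
    ... | p , prime-p , p∣n = begin
        Vanishes f n                            ≈⟨ vanishes-step condIV n ⟨
        Vanishes f (f n)                        ≈⟨ claim-below fn<n ⟩
        Absorbed f (f n)                        ≡⟨ cong (Absorbed f) (f-split {f} multiplicative prime-p s) ⟩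
        Absorbed f (f pᵅ * f m)                 ≈⟨ absorbed-* (f pᵅ) (f m) ⟩
        (Absorbed f (f pᵅ) ⊎ Absorbed f (f m))  ≈⟨ absorbed-f-pᵅ⇔vanishes-p ⊎-⇔ absorbed-fm⇔vanishes-m ⟩
        (Vanishes f p ⊎ Vanishes f m)           ≈⟨ ⇔-sym (absorbed-prime-power prime-p α≥1) ⊎-⇔ claim-below m<n ⟩
        (Absorbed f pᵅ ⊎ Absorbed f m)          ≈⟨ absorbed-* pᵅ m ⟨
        Absorbed f (pᵅ * m)                     ≡⟨ cong (Absorbed f) (decomposition s) ⟨
        Absorbed f n                            ∎
      where
      open ⇔-Reasoning
      s : Split p n
      s = split prime-p n
      pᵅ m : ℕ
      pᵅ = p ^ exponent s
      m  = cofactor s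
      α≥1 : 1 ≤ exponent s
      α≥1 = split-exponent≥1 prime-p s p∣n
      m<n : m < n
      m<n = split-cofactor< prime-p s p∣n
      instance
        m-nonzero : NonZero m
        m-nonzero = split-cofactor≢0 prime-p s
      fm<n : f m < n
      fm<n = ≤-<-trans (f≤id {f} multiplicative condI m (>-nonZero⁻¹ m)) m<n
      fp<n : f p < n
      fp<n = <-≤-trans (f<id {f} multiplicative condI p (prime>1 prime-p)) (∣⇒≤ p∣n)
      fn<n : f n < n
      fn<n = f<id {f} multiplicative condI n (s≤s (s≤s z≤n))
      absorbed-f-pᵅ⇔vanishes-p : Absorbed f (f pᵅ) ⇔ Vanishes f p
      absorbed-f-pᵅ⇔vanishes-p = absorbed-f-prime-power condII condIII condIV prime-p α≥1 (claim-below fp<n)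
      absorbed-fm⇔vanishes-m : Absorbed f (f m) ⇔ Vanishes f m
      absorbed-fm⇔vanishes-m = vanishes-step condIV m ⇔-∘ ⇔-sym (claim-below fm<n)

  inS⇔¬vanishes : ∀ n → InS f n ⇔ (¬ Vanishes f n)
  inS⇔¬vanishes n = mk⇔ forward backward
    where
    forward : InS f n → ¬ Vanishes f n
    forward (n≥1 , no-Q-divisor) vn with to (vanishes⇔absorbed n) vn
    ... | inj₁ refl = contradiction n≥1 λ ()
    ... | inj₂ (q , prime-q , vq , q∣n) = no-Q-divisor q (prime-q , to (vanishes⇔limit condIV q) vq) q∣n
    backward : ¬ Vanishes f n → InS f n
    backward ¬vn = n≢0⇒n>0 (λ n≡0 → ¬vn (0 , n≡0)) , λ q (prime-q , limit-q) q∣n →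
      ¬vn (from (vanishes⇔absorbed n) (inj₂ (q , prime-q , from (vanishes⇔limit condIV q) limit-q , q∣n)))

corollary1p1 : (f : ℕ → ℕ) → Multiplicative f → CondI f → CondII f → CondIII f → CondIV f →
    (k r : ℕ) → 1 ≤ k → 1 ≤ r → (InS f (iter f r k) ⇔ InS f k)
corollary1p1 f multiplicative condI condII condIII condIV k r _ _ = begin
  InS f (iter f r k)          ≈⟨ inS⇔¬vanishes′ (iter f r k) ⟩
  ¬ Vanishes f (iter f r k)   ≈⟨ ¬-cong-⇔ (vanishes-iter condIV r k) ⟩
  ¬ Vanishes f k              ≈⟨ inS⇔¬vanishes′ k ⟨
  InS f k                     ∎
  where
  open ⇔-Reasoning
  inS⇔¬vanishes′ : ∀ n → InS f n ⇔ (¬ Vanishes f n)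
  inS⇔¬vanishes′ = inS⇔¬vanishes multiplicative condI condII condIII condIV
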